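{- Let $n$ be a positive integer and let $H=K_{3^{3n-2}}[K_3\square K_3]$. Then \[\chi_l(H)\ge \frac{10}{9}\cdot 3^{3n-1}-1.\]
   Context: The cartesian product $G\square H$ has vertex set $V(G)\times V(H)$, with $(g_1,h_1)$ adjacent to $(g_2,h_2)$ iff either $h_1=h_2$ and $g_1g_2\in E(G)$, or $g_1=g_2$ and $h_1h_2\in E(H)$. The lexicographic product $G[H]$ has vertex set $V(G)\times V(H)$, with $(g_1,h_1)$ adjacent to $(g_2,h_2)$ iff either $g_1g_2\in E(G)$, or $g_1=g_2$ and $h_1h_2\in E(H)$. $K_r$ is the complete graph on $r$ vertices. $\chi_l(H)$ is the list chromatic number: the least $t$ such that for every assignment of lists $L(v)$ with $|L(v)|\ge t$ there is a proper coloring $\phi$ with $\phi(v)\in L(v)$ for all $v$. -}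

module Defs where

open import Data.Nat using (ℕ; _≤_)
open import Data.Fin using (Fin)
open import Data.Product using (Σ; _×_; _,_)
open import Data.Sum using (_⊎_)
open import Data.List using (List; length)
open import Data.List.Membership.Propositional using (_∈_)
open import Data.List.Relation.Unary.Unique.Propositional using (Unique)
open import Relation.Binary.PropositionalEquality using (_≡_; _≢_)

record Graph : Set₁ where
  field
    V   : Set
    Adj : V → V → Set
open Graph public

K : ℕ → Graph
K r = record { V = Fin r ; Adj = λ i j → i ≢ j }

_□_ : Graph → Graph → Graph
G □ H = record
  { V   = V G × V H
  ; Adj = λ { (g₁ , h₁) (g₂ , h₂) →
            (h₁ ≡ h₂ × Adj G g₁ g₂) ⊎ (g₁ ≡ g₂ × Adj H h₁ h₂) } }

lex : Graph → Graph → Graph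
lex G H = record
  { V   = V G × V H
  ; Adj = λ { (g₁ , h₁) (g₂ , h₂) →
            Adj G g₁ g₂ ⊎ (g₁ ≡ g₂ × Adj H h₁ h₂) } }

ProperLColouring : (G : Graph) → (V G → List ℕ) → Set
ProperLColouring G L =
  Σ (V G → ℕ) (λ φ →
    ((v : V G) → φ v ∈ L v) × (∀ u v → Adj G u v → φ u ≢ φ v))

Choosable : Graph → ℕ → Set
Choosable G t = (L : V G → List ℕ) →
  ((v : V G) → Unique (L v) × t ≤ length (L v)) →
  ProperLColouring G L

-- Give each vertex in row a of every copy of K₃ □ K₃ the colours below 3p
-- whose residue mod 3 is a or a + 1: a list of 2p ≥ t colours. A colour then
-- occurs in at most two rows of a copy and at most once per row, so a copy
-- uses at least ⌈9/2⌉ = 5 colours, and different copies, being completely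
-- joined, use disjoint colour sets. Hence 5 · 3^(3n-2) ≤ 3p for p = ⌈t/2⌉.

module Submission where

open import Defs
open import Data.Nat using (ℕ; _≤_; _*_; _+_; _∸_; _^_)
open import Data.Nat as ℕ using (zero; suc; _<_; z≤n; s≤s)
import Data.Nat.Properties as ℕ
open import Data.Nat.Tactic.RingSolver using (solve-∀)
open import Data.Fin as Fin using (Fin; toℕ; fromℕ<; combine; remQuot; inject≤)
open import Data.Fin.Patterns using (0F; 1F; 2F)
import Data.Fin.Properties as Fin
open import Data.Product using (_×_; _,_; proj₁; proj₂; ∃)
open import Data.Sum using (inj₁; inj₂)
open import Data.List using (List; _∷_; length; tabulate; deduplicate; lookup)
import Data.List.Properties as List
open import Data.List.Membership.Propositional using (_∈_)
open import Data.List.Membership.Propositional.Properties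
  using (∈-tabulate⁺; ∈-tabulate⁻; ∈-deduplicate⁺; ∈-deduplicate⁻; ∈-lookup)
import Data.List.Membership.Setoid.Properties as Membershipₛ
open import Data.List.Relation.Unary.Any using (index)
import Data.List.Relation.Unary.All as All
open import Data.List.Relation.Unary.Unique.Propositional using (Unique)
open import Data.List.Relation.Unary.AllPairs using (_∷_)
import Data.List.Relation.Unary.Unique.Propositional.Properties as Unique
import Data.List.Relation.Unary.Unique.DecPropositional.Properties as Uniqueᵈ
open import Function using (_∘_; Injective)
open import Function.Bundles using (Injection)
open import Function.Properties.Inverse using (↔⇒↣)
open import Relation.Binary.PropositionalEquality
open import Relation.Nullary using (yes; no; contradiction)

remQuot-injective : ∀ {m} n → Injective _≡_ _≡_ (remQuot {m} n)
remQuot-injective n = Injection.injective (↔⇒↣ Fin.*↔×)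

bounded-injective⇒≤ : ∀ {m k} (f : Fin m → ℕ) → (∀ x → f x < k) →
                      Injective _≡_ _≡_ f → m ≤ k
bounded-injective⇒≤ f f<k f-inj = Fin.injective⇒≤ {f = λ x → fromℕ< (f<k x)}
  (λ {x} {y} eq → f-inj (begin
    f x                  ≡⟨ Fin.toℕ-fromℕ< (f<k x) ⟨
    toℕ (fromℕ< (f<k x)) ≡⟨ cong toℕ eq ⟩
    toℕ (fromℕ< (f<k y)) ≡⟨ Fin.toℕ-fromℕ< (f<k y) ⟩
    f y                  ∎))
  where open ≡-Reasoning

Unique⇒lookup-injective : ∀ {xs : List ℕ} → Unique xs → Injective _≡_ _≡_ (lookup xs)
Unique⇒lookup-injective {_ ∷ _} (_ ∷ _) {0F} {0F} _ = refl
Unique⇒lookup-injective {_ ∷ _} (x∉xs ∷ _) {0F} {Fin.suc j} eq =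
  contradiction eq (All.lookup x∉xs (∈-lookup j))
Unique⇒lookup-injective {_ ∷ _} (x∉xs ∷ _) {Fin.suc i} {0F} eq =
  contradiction (sym eq) (All.lookup x∉xs (∈-lookup i))
Unique⇒lookup-injective {_ ∷ _} (_ ∷ u) {Fin.suc i} {Fin.suc j} eq =
  cong Fin.suc (Unique⇒lookup-injective u eq)

disjoint-Unique⇒*≤ : ∀ {m s k} (U : Fin m → List ℕ) →
  (∀ i → Unique (U i)) → (∀ i → s ≤ length (U i)) →
  (∀ i {x} → x ∈ U i → x < k) →
  (∀ i j {x} → x ∈ U i → x ∈ U j → i ≡ j) →
  m * s ≤ k
disjoint-Unique⇒*≤ {m} {s} U U-unique s≤∣U∣ U<k U-disjoint =
  bounded-injective⇒≤ (pick ∘ remQuot s)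
    (λ x → U<k _ (∈-lookup _))
    (λ eq → remQuot-injective s (pick-injective eq))
  where
  pick : Fin m × Fin s → ℕ
  pick (i , r) = lookup (U i) (inject≤ r (s≤∣U∣ i))

  pick-injective : Injective _≡_ _≡_ pick
  pick-injective {i , r} {j , r′} eq
    with refl ← U-disjoint i j (∈-lookup _) (subst (_∈ U j) (sym eq) (∈-lookup _))
    = cong (i ,_) (Fin.inject≤-injective _ _ r r′ (Unique⇒lookup-injective (U-unique i) eq))

image : ∀ {m} → (Fin m → ℕ) → List ℕ
image f = deduplicate ℕ._≟_ (tabulate f)

image-unique : ∀ {m} (f : Fin m → ℕ) → Unique (image f)
image-unique f = Uniqueᵈ.deduplicate-! ℕ._≟_ (tabulate f)

∈-image⁺ : ∀ {m} (f : Fin m → ℕ) x → f x ∈ image f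
∈-image⁺ f x = ∈-deduplicate⁺ ℕ._≟_ (∈-tabulate⁺ x)

∈-image⁻ : ∀ {m} (f : Fin m → ℕ) {y} → y ∈ image f → ∃ λ x → y ≡ f x
∈-image⁻ f y∈ = ∈-tabulate⁻ (∈-deduplicate⁻ ℕ._≟_ (tabulate f) y∈)

image-length : ∀ {m k} (f : Fin m → ℕ) (g : Fin m → Fin k) →
  (∀ {x y} → f x ≡ f y → g x ≡ g y → x ≡ y) →
  m ≤ length (image f) * k
image-length {m} f g fg-inj = Fin.injective⇒≤ {f = λ x → combine (position x) (g x)}
  λ {x} {y} eq → let pos≡ , g≡ = Fin.combine-injective _ _ _ _ eq in
    fg-inj (Membershipₛ.index-injective (setoid ℕ) (∈-image⁺ f x) (∈-image⁺ f y) pos≡) g≡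
  where
  position : Fin m → Fin (length (image f))
  position x = index (∈-image⁺ f x)

-- Row a of K₃ □ K₃ may use the colour classes a and a + 1 (mod 3).
shift : Fin 3 → Fin 2 → Fin 3
shift 0F 0F = 0F
shift 0F 1F = 1F
shift 1F 0F = 1F
shift 1F 1F = 2F
shift 2F 0F = 2F
shift 2F 1F = 0F

shift-injectiveʳ : ∀ a {j j′} → shift a j ≡ shift a j′ → j ≡ j′
shift-injectiveʳ 0F {0F} {0F} _ = refl
shift-injectiveʳ 0F {1F} {1F} _ = refl
shift-injectiveʳ 1F {0F} {0F} _ = refl
shift-injectiveʳ 1F {1F} {1F} _ = refl
shift-injectiveʳ 2F {0F} {0F} _ = refl
shift-injectiveʳ 2F {1F} {1F} _ = refl
shift-injectiveʳ 0F {0F} {1F} ()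
shift-injectiveʳ 0F {1F} {0F} ()
shift-injectiveʳ 1F {0F} {1F} ()
shift-injectiveʳ 1F {1F} {0F} ()
shift-injectiveʳ 2F {0F} {1F} ()
shift-injectiveʳ 2F {1F} {0F} ()

shift-injectiveˡ : ∀ j {a a′} → shift a j ≡ shift a′ j → a ≡ a′
shift-injectiveˡ 0F {0F} {0F} _ = refl
shift-injectiveˡ 0F {1F} {1F} _ = refl
shift-injectiveˡ 0F {2F} {2F} _ = refl
shift-injectiveˡ 1F {0F} {0F} _ = refl
shift-injectiveˡ 1F {1F} {1F} _ = refl
shift-injectiveˡ 1F {2F} {2F} _ = refl
shift-injectiveˡ 0F {0F} {1F} ()
shift-injectiveˡ 0F {0F} {2F} ()
shift-injectiveˡ 0F {1F} {0F} ()
shift-injectiveˡ 0F {1F} {2F} ()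
shift-injectiveˡ 0F {2F} {0F} ()
shift-injectiveˡ 0F {2F} {1F} ()
shift-injectiveˡ 1F {0F} {1F} ()
shift-injectiveˡ 1F {0F} {2F} ()
shift-injectiveˡ 1F {1F} {0F} ()
shift-injectiveˡ 1F {1F} {2F} ()
shift-injectiveˡ 1F {2F} {0F} ()
shift-injectiveˡ 1F {2F} {1F} ()

-- toℕ (combine k c) = 3k + c, so shift a j is the residue mod 3 of the colour.
colour : ∀ p → Fin 3 → Fin p × Fin 2 → ℕ
colour p a (k , j) = toℕ (combine k (shift a j))

colour< : ∀ p a x → colour p a x < p * 3
colour< p a (k , j) = Fin.toℕ<n (combine k (shift a j))

colour-injective : ∀ p a → Injective _≡_ _≡_ (colour p a)
colour-injective p a {k , j} {k′ , j′} eq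
  with k≡k′ , shift≡ ← Fin.combine-injective k _ k′ _ (Fin.toℕ-injective eq)
  = cong₂ _,_ k≡k′ (shift-injectiveʳ a shift≡)

colour-row : ∀ p {a a′ x y} → colour p a x ≡ colour p a′ y → proj₂ x ≡ proj₂ y → a ≡ a′
colour-row p {a} {a′} {k , j} {k′ , _} eq refl =
  shift-injectiveˡ j (proj₂ (Fin.combine-injective k (shift a j) k′ (shift a′ j)
                                                    (Fin.toℕ-injective eq)))

rowList : ℕ → Fin 3 → List ℕ
rowList p a = tabulate (colour p a ∘ remQuot 2)

rowList-unique : ∀ p a → Unique (rowList p a)
rowList-unique p a = Unique.tabulate⁺ (remQuot-injective 2 ∘ colour-injective p a)

rowList-length : ∀ p a → length (rowList p a) ≡ p * 2
rowList-length p a = List.length-tabulate (colour p a ∘ remQuot 2)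

H : ℕ → Graph
H N = lex (K N) (K 3 □ K 3)

rowLists : ∀ {N} p → V (H N) → List ℕ
rowLists p (_ , a , _) = rowList p a

module RowListColouring {N p} (φ : V (H N) → ℕ) (φ∈L : ∀ v → φ v ∈ rowLists p v)
                        (proper : ∀ u v → Adj (H N) u v → φ u ≢ φ v) where

  decode : ∀ i a b → ∃ λ x → φ (i , a , b) ≡ colour p a x
  decode i a b with z , eq ← ∈-tabulate⁻ (φ∈L (i , a , b)) = remQuot 2 z , eq

  tag : V (H N) → Fin 2
  tag (i , a , b) = proj₂ (proj₁ (decode i a b))

  φ< : ∀ v → φ v < p * 3
  φ< (i , a , b) with x , eq ← decode i a b = subst (_< p * 3) (sym eq) (colour< p a x)

  copy-injective : ∀ i {x y} → φ (i , x) ≡ φ (i , y) → tag (i , x) ≡ tag (i , y) → x ≡ y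
  copy-injective i {a , b} {a′ , b′} eq tag≡
    with refl ← colour-row p (trans (sym (proj₂ (decode i a b)))
                                    (trans eq (proj₂ (decode i a′ b′)))) tag≡
    with b Fin.≟ b′
  ... | yes b≡b′ = cong (a ,_) b≡b′
  ... | no b≢b′ = contradiction eq (proper _ _ (inj₂ (refl , inj₂ (refl , b≢b′))))

  copies-disjoint : ∀ {i j x y} → φ (i , x) ≡ φ (j , y) → i ≡ j
  copies-disjoint {i} {j} eq with i Fin.≟ j
  ... | yes i≡j = i≡j
  ... | no i≢j = contradiction eq (proper _ _ (inj₁ i≢j))

  φ₉ : Fin N → Fin 9 → ℕ
  φ₉ i q = φ (i , remQuot 3 q)

  palette : Fin N → List ℕ
  palette i = image (φ₉ i)

  5≤∣palette∣ : ∀ i → 5 ≤ length (palette i)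
  5≤∣palette∣ i = ℕ.*-cancelʳ-< 2 4 _ (image-length (φ₉ i) (λ q → tag (i , remQuot 3 q))
    (λ eq tag≡ → remQuot-injective 3 (copy-injective i eq tag≡)))

  palette< : ∀ i {c} → c ∈ palette i → c < p * 3
  palette< i c∈ with q , refl ← ∈-image⁻ (φ₉ i) c∈ = φ< (i , remQuot 3 q)

  palettes-disjoint : ∀ i j {c} → c ∈ palette i → c ∈ palette j → i ≡ j
  palettes-disjoint i j c∈ c∈′
    with _ , refl ← ∈-image⁻ (φ₉ i) c∈ | _ , eq ← ∈-image⁻ (φ₉ j) c∈′
    = copies-disjoint eq

  copies*5≤colours : N * 5 ≤ p * 3
  copies*5≤colours = disjoint-Unique⇒*≤ palette (image-unique ∘ φ₉) 5≤∣palette∣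
    palette< palettes-disjoint

choosable⇒*5≤ : ∀ N p {t} → Choosable (H N) t → t ≤ p * 2 → N * 5 ≤ p * 3
choosable⇒*5≤ N p {t} choose t≤2p
  with φ , φ∈L , proper ← choose (rowLists p)
         (λ (_ , a , _) → rowList-unique p a , subst (t ≤_) (sym (rowList-length p a)) t≤2p)
  = RowListColouring.copies*5≤colours {p = p} φ φ∈L proper

⌈n/2⌉*2-bounds : ∀ n → n ≤ ℕ.⌈ n /2⌉ * 2 × ℕ.⌈ n /2⌉ * 2 ≤ suc n
⌈n/2⌉*2-bounds zero = z≤n , z≤n
⌈n/2⌉*2-bounds (suc zero) = s≤s z≤n , ℕ.≤-refl
⌈n/2⌉*2-bounds (suc (suc n)) with lower , upper ← ⌈n/2⌉*2-bounds n =
  s≤s (s≤s lower) , s≤s (s≤s upper)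

3n∸1≡1+[3n∸2] : ∀ n → 1 ≤ n → 3 * n ∸ 1 ≡ suc (3 * n ∸ 2)
3n∸1≡1+[3n∸2] (suc m) _ =
  trans (cong (_∸ 1) (ℕ.*-suc 3 m)) (cong (λ k → suc (k ∸ 2)) (sym (ℕ.*-suc 3 m)))

lemma8 : (n : ℕ) → 1 ≤ n → (t : ℕ) →
    Choosable (lex (K (3 ^ (3 * n ∸ 2))) (K 3 □ K 3)) t →
    10 * 3 ^ (3 * n ∸ 1) ≤ 9 * (t + 1)
lemma8 n 1≤n t choose = begin
  10 * 3 ^ (3 * n ∸ 1) ≡⟨ cong (λ k → 10 * 3 ^ k) (3n∸1≡1+[3n∸2] n 1≤n) ⟩
  10 * (3 * N)         ≡⟨ 10*3≡6*5 N ⟩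
  6 * (N * 5)          ≤⟨ ℕ.*-monoʳ-≤ 6 (choosable⇒*5≤ N p choose t≤2p) ⟩
  6 * (p * 3)          ≡⟨ 6*3≡9*2 p ⟩
  9 * (p * 2)          ≤⟨ ℕ.*-monoʳ-≤ 9 2p≤1+t ⟩
  9 * suc t            ≡⟨ cong (9 *_) (ℕ.+-comm 1 t) ⟩
  9 * (t + 1)          ∎
  where
  open ℕ.≤-Reasoning
  N p : ℕ
  N = 3 ^ (3 * n ∸ 2)
  p = ℕ.⌈ t /2⌉
  t≤2p : t ≤ p * 2
  t≤2p = proj₁ (⌈n/2⌉*2-bounds t)
  2p≤1+t : p * 2 ≤ suc t
  2p≤1+t = proj₂ (⌈n/2⌉*2-bounds t)
  10*3≡6*5 : ∀ N → 10 * (3 * N) ≡ 6 * (N * 5)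
  10*3≡6*5 = solve-∀
  6*3≡9*2 : ∀ p → 6 * (p * 3) ≡ 9 * (p * 2)
  6*3≡9*2 = solve-∀
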